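{- Let $k$ be an integer with $1<k\le 15$. The $k$-simplex numbers are $\binom{m+k-1}{k}$ for positive integers $m$. For a positive integer $n$ put $s=\left\lfloor\sqrt[k]{k!\,n}\right\rfloor$ and $t=\left\lfloor\frac{k}{2}\right\rfloor$. Then the $n$-th smallest positive integer that is not a $k$-simplex number equals $$a(n)=\begin{cases} n+s-t+2 & \text{if } n+s-t+1\ge\binom{s+\lceil k/2\rceil+1}{k},\\ n+s-t & \text{if } n+s-t<\binom{s+\lceil k/2\rceil}{k},\\ n+s-t+1 & \text{otherwise.}\end{cases}$$ -}

module Defs where

open import Data.Nat using (ℕ; suc; _+_; _*_; _^_; _≤_; _<_; _∸_; _!)
open import Data.Nat.Combinatorics using (_C_)
open import Data.Fin using (Fin; toℕ)
open import Data.Product using (Σ; ∃; _×_; _,_)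
open import Relation.Binary.PropositionalEquality using (_≡_)
open import Relation.Nullary using (¬_)

IsSimplex : ℕ → ℕ → Set
IsSimplex k x = ∃ λ m → 1 ≤ m × x ≡ (m + k ∸ 1) C k

NonSimplex : ℕ → ℕ → Set
NonSimplex k x = 1 ≤ x × ¬ IsSimplex k x

-- a is the n-th smallest (n ≥ 1) positive non-k-simplex number:
-- there is a strictly increasing enumeration f : Fin n → ℕ of non-simplex
-- numbers, listing all positive non-simplex numbers ≤ a, whose last entry is a.
NthNonSimplex : ℕ → ℕ → ℕ → Set
NthNonSimplex k n a =
  Σ (Fin n → ℕ) λ f →
    (∀ i → NonSimplex k (f i)) ×
    (∀ i j → toℕ i Data.Nat.< toℕ j → f i < f j) ×
    (∀ i → f i ≤ a) ×
    (∃ λ i → f i ≡ a) ×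
    (∀ x → NonSimplex k x → x ≤ a → ∃ λ i → f i ≡ x)

IsFloorRoot : ℕ → ℕ → ℕ → Set
IsFloorRoot k N s = s ^ k ≤ N × N < suc s ^ k

{-# OPTIONS --safe #-}
module Submission where

-- Write T m = C(m+k-1, k). The positive non-simplex numbers are those strictly between
-- consecutive T m, and for k ≥ 2 every gap T (m+1) < x < T (m+2) is non-empty. Hence the
-- i-th non-simplex number is i + m, where m is the index of its gap, and a = n + m as soon
-- as T m < n + m < T (m+1).
-- Put s = ⌊k/2⌋ + j. Since k! T m = m (m+1) ⋯ (m+k-1), the root bounds s^k ≤ k! n < (s+1)^k
-- together with two polynomial inequalities in j (checked coefficientwise for each k ≤ 15)
-- give T j < n + j and n + j + 2 < T (j+3); the three cases of the formula say which of
-- n + j + 2, n + j, n + j + 1 lies in gap j + 2, j, j + 1 respectively. If s < ⌊k/2⌋ then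
-- k! n < ⌊k/2⌋^k leaves finitely many n, and these are checked by evaluation.

open import Defs
open import Data.Nat using (ℕ; _+_; _≤_; _<_; _*_; _!; ⌊_/2⌋; ⌈_/2⌉)
open import Data.Nat.Combinatorics using (_C_)
open import Data.Integer using (ℤ; +_) renaming (_+_ to _+ℤ_; _-_ to _-ℤ_; _≤_ to _≤ℤ_; _<_ to _<ℤ_)
open import Data.Product using (_×_)
open import Data.Sum using (_⊎_)
open import Relation.Nullary using (¬_)
open import Relation.Binary.PropositionalEquality using (_≡_)

open import Data.Bool using (Bool; true; T; _∧_)
open import Data.Bool.Properties using (T-∧)
open import Data.Empty using (⊥-elim)
open import Data.Fin using (Fin; zero; suc; toℕ; inject₁; fromℕ)
open import Data.Fin.Induction using (<-weakInduction)
open import Data.Fin.Properties using (toℕ-inject₁; toℕ-fromℕ; toℕ≤pred[n]; toℕ-injective)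
open import Data.Integer using (+≤+; +<+; _⊖_)
import Data.Integer.Properties as ℤ
open import Data.List using (List; []; _∷_; map)
open import Data.Nat using (zero; suc; 2+; _^_; _∸_; _≤ᵇ_; z≤n; s≤s)
open import Data.Nat.Combinatorics
  using (_P_; nCk≡nPk/k!; nCk+nC[k+1]≡[n+1]C[k+1]; k>n⇒nCk≡0; nCn≡1; nPk≡n!/[n∸k]!)
open import Data.Nat.Combinatorics.Base using (_P′_)
open import Data.Nat.Combinatorics.Specification using (k!∣nP′k; nP′k≡n!/[n∸k]!)
open import Data.Nat.DivMod using (_/_; m*[n/m]≡n; m*n/n≡m; /-monoˡ-≤)
open import Data.Nat.Properties
import Algebra.Properties.CommutativeSemigroup as CommutativeSemigroupProperties
open import Data.Product using (∃; _,_)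
open import Data.Sum using (inj₁; inj₂; [_,_]′)
open import Function using (Equivalence; _∘_)
open import Relation.Nullary using (Dec; yes; no)
open import Relation.Nullary.Decidable using (map′; _×-dec_; _⊎-dec_; _→-dec_; ¬?; T?; toWitness)
open import Relation.Binary.PropositionalEquality
  using (refl; sym; trans; cong; cong₂; subst; subst₂; module ≡-Reasoning)
open import Relation.Binary.Definitions using (tri<; tri≈; tri>)

module ℕ+ = CommutativeSemigroupProperties +-commutativeSemigroup
module ℕ* = CommutativeSemigroupProperties *-commutativeSemigroup

Poly : Set
Poly = List ℕ

⟦_⟧ : Poly → ℕ → ℕ
⟦ [] ⟧ x = 0
⟦ c ∷ p ⟧ x = c + x * ⟦ p ⟧ x

infixl 6 _⊕_
infixl 7 _⊗_ _⊛_
infixr 8 _^ᴾ_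
infix 4 _≤ᶜ_

_⊕_ : Poly → Poly → Poly
[] ⊕ q = q
(a ∷ p) ⊕ [] = a ∷ p
(a ∷ p) ⊕ (b ∷ q) = a + b ∷ p ⊕ q

_⊛_ : ℕ → Poly → Poly
a ⊛ p = map (a *_) p

_⊗_ : Poly → Poly → Poly
[] ⊗ q = []
(a ∷ p) ⊗ q = a ⊛ q ⊕ (0 ∷ p ⊗ q)

_^ᴾ_ : Poly → ℕ → Poly
p ^ᴾ zero = 1 ∷ []
p ^ᴾ suc k = p ⊗ p ^ᴾ k

X+ : ℕ → Poly
X+ c = c ∷ 1 ∷ []

⟦const⟧ : ∀ c x → ⟦ c ∷ [] ⟧ x ≡ c
⟦const⟧ c x = trans (cong (_+_ c) (*-zeroʳ x)) (+-identityʳ c)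

⟦X+⟧ : ∀ c x → ⟦ X+ c ⟧ x ≡ c + x
⟦X+⟧ c x = cong (_+_ c) (trans (cong (x *_) (⟦const⟧ 1 x)) (*-identityʳ x))

⟦⊕⟧ : ∀ p q x → ⟦ p ⊕ q ⟧ x ≡ ⟦ p ⟧ x + ⟦ q ⟧ x
⟦⊕⟧ [] q x = refl
⟦⊕⟧ (a ∷ p) [] x = sym (+-identityʳ _)
⟦⊕⟧ (a ∷ p) (b ∷ q) x = begin
  a + b + x * ⟦ p ⊕ q ⟧ x             ≡⟨ cong (λ r → a + b + x * r) (⟦⊕⟧ p q x) ⟩
  a + b + x * (⟦ p ⟧ x + ⟦ q ⟧ x)     ≡⟨ cong (_+_ (a + b)) (*-distribˡ-+ x (⟦ p ⟧ x) (⟦ q ⟧ x)) ⟩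
  a + b + (x * ⟦ p ⟧ x + x * ⟦ q ⟧ x) ≡⟨ ℕ+.interchange a b _ _ ⟩
  a + x * ⟦ p ⟧ x + (b + x * ⟦ q ⟧ x) ∎
  where open ≡-Reasoning

⟦⊛⟧ : ∀ a p x → ⟦ a ⊛ p ⟧ x ≡ a * ⟦ p ⟧ x
⟦⊛⟧ a [] x = sym (*-zeroʳ a)
⟦⊛⟧ a (b ∷ p) x = begin
  a * b + x * ⟦ a ⊛ p ⟧ x   ≡⟨ cong (λ r → a * b + x * r) (⟦⊛⟧ a p x) ⟩
  a * b + x * (a * ⟦ p ⟧ x) ≡⟨ cong (_+_ (a * b)) (ℕ*.x∙yz≈y∙xz x a _) ⟩
  a * b + a * (x * ⟦ p ⟧ x) ≡⟨ *-distribˡ-+ a b _ ⟨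
  a * (b + x * ⟦ p ⟧ x)     ∎
  where open ≡-Reasoning

⟦⊗⟧ : ∀ p q x → ⟦ p ⊗ q ⟧ x ≡ ⟦ p ⟧ x * ⟦ q ⟧ x
⟦⊗⟧ [] q x = refl
⟦⊗⟧ (a ∷ p) q x = begin
  ⟦ a ⊛ q ⊕ (0 ∷ p ⊗ q) ⟧ x             ≡⟨ ⟦⊕⟧ (a ⊛ q) (0 ∷ p ⊗ q) x ⟩
  ⟦ a ⊛ q ⟧ x + x * ⟦ p ⊗ q ⟧ x         ≡⟨ cong₂ (λ l r → l + x * r) (⟦⊛⟧ a q x) (⟦⊗⟧ p q x) ⟩
  a * ⟦ q ⟧ x + x * (⟦ p ⟧ x * ⟦ q ⟧ x) ≡⟨ cong (_+_ (a * ⟦ q ⟧ x)) (*-assoc x _ _) ⟨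
  a * ⟦ q ⟧ x + x * ⟦ p ⟧ x * ⟦ q ⟧ x   ≡⟨ *-distribʳ-+ (⟦ q ⟧ x) a _ ⟨
  (a + x * ⟦ p ⟧ x) * ⟦ q ⟧ x           ∎
  where open ≡-Reasoning

⟦^ᴾ⟧ : ∀ p k x → ⟦ p ^ᴾ k ⟧ x ≡ ⟦ p ⟧ x ^ k
⟦^ᴾ⟧ p zero x = ⟦const⟧ 1 x
⟦^ᴾ⟧ p (suc k) x = trans (⟦⊗⟧ p (p ^ᴾ k) x) (cong (⟦ p ⟧ x *_) (⟦^ᴾ⟧ p k x))

_≤ᶜ_ : Poly → Poly → Bool
[] ≤ᶜ q = true
(a ∷ p) ≤ᶜ [] = (a ≤ᵇ 0) ∧ (p ≤ᶜ [])
(a ∷ p) ≤ᶜ (b ∷ q) = (a ≤ᵇ b) ∧ (p ≤ᶜ q)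

≤ᶜ⇒⟦⟧≤ : ∀ p q → T (p ≤ᶜ q) → ∀ x → ⟦ p ⟧ x ≤ ⟦ q ⟧ x
≤ᶜ⇒⟦⟧≤ [] q _ x = z≤n
≤ᶜ⇒⟦⟧≤ (a ∷ p) [] h x =
  let a≤0 , p≤0 = Equivalence.to T-∧ h
  in +-mono-≤ (≤ᵇ⇒≤ a 0 a≤0)
       (≤-trans (*-monoʳ-≤ x (≤ᶜ⇒⟦⟧≤ p [] p≤0 x)) (≤-reflexive (*-zeroʳ x)))
≤ᶜ⇒⟦⟧≤ (a ∷ p) (b ∷ q) h x =
  let a≤b , p≤q = Equivalence.to T-∧ h
  in +-mono-≤ (≤ᵇ⇒≤ a b a≤b) (*-monoʳ-≤ x (≤ᶜ⇒⟦⟧≤ p q p≤q x))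

module Enumeration {P : ℕ → Set} {n a : ℕ} (f : Fin (suc n) → ℕ)
  (satisfies : ∀ i → P (f i))
  (increasing : ∀ i j → toℕ i < toℕ j → f i < f j)
  (bounded : ∀ i → f i ≤ a)
  (attains : ∃ λ i → f i ≡ a)
  (complete : ∀ x → P x → x ≤ a → ∃ λ i → f i ≡ x)
  where

  monotone : ∀ i j → toℕ i ≤ toℕ j → f i ≤ f j
  monotone i j i≤j with m≤n⇒m<n∨m≡n i≤j
  ... | inj₁ i<j = <⇒≤ (increasing i j i<j)
  ... | inj₂ i≡j = ≤-reflexive (cong f (toℕ-injective i≡j))

  least-at : ∀ {y} i → P y → y ≤ f i → (∀ l → toℕ l < toℕ i → f l < y) → f i ≡ y
  least-at i Py y≤fi before with complete _ Py (≤-trans y≤fi (bounded i))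
  ... | l , fl≡y with toℕ l <? toℕ i
  ...   | yes l<i = ⊥-elim (<-irrefl fl≡y (before l l<i))
  ...   | no l≮i = ≤-antisym (subst (f i ≤_) fl≡y (monotone i l (≮⇒≥ l≮i))) y≤fi

  first-least : ∀ {y} → P y → (∀ z → z < y → ¬ P z) → f zero ≡ y
  first-least Py none = least-at zero Py (≮⇒≥ (λ f0<y → none _ f0<y (satisfies zero))) (λ _ ())

  next-least : ∀ i {y} → P y → f (inject₁ i) < y →
    (∀ z → f (inject₁ i) < z → z < y → ¬ P z) → f (suc i) ≡ y
  next-least i {y} Py fi<y none = least-at (suc i) Py y≤fsi before
    where
    fi<fsi : f (inject₁ i) < f (suc i)
    fi<fsi = increasing (inject₁ i) (suc i) (s≤s (≤-reflexive (toℕ-inject₁ i)))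
    y≤fsi : y ≤ f (suc i)
    y≤fsi = ≮⇒≥ (λ fsi<y → none _ fi<fsi fsi<y (satisfies (suc i)))
    before : ∀ l → toℕ l < suc (toℕ i) → f l < y
    before l (s≤s l≤i) =
      ≤-<-trans (monotone l (inject₁ i) (subst (toℕ l ≤_) (sym (toℕ-inject₁ i)) l≤i)) fi<y

  last≡a : f (fromℕ n) ≡ a
  last≡a = let i , fi≡a = attains in
    ≤-antisym (bounded (fromℕ n)) (subst (_≤ f (fromℕ n)) fi≡a
      (monotone i (fromℕ n) (subst (toℕ i ≤_) (sym (toℕ-fromℕ n)) (toℕ≤pred[n] i))))

rising : ℕ → ℕ → ℕ
rising x zero = 1
rising x (suc k) = x * rising (suc x) k

risingᴾ : ℕ → ℕ → Poly
risingᴾ c zero = 1 ∷ []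
risingᴾ c (suc k) = X+ c ⊗ risingᴾ (suc c) k

⟦risingᴾ⟧ : ∀ c k x → ⟦ risingᴾ c k ⟧ x ≡ rising (c + x) k
⟦risingᴾ⟧ c zero x = ⟦const⟧ 1 x
⟦risingᴾ⟧ c (suc k) x =
  trans (⟦⊗⟧ (X+ c) (risingᴾ (suc c) k) x) (cong₂ _*_ (⟦X+⟧ c x) (⟦risingᴾ⟧ (suc c) k x))

boundᴾ : ℕ → ℕ → ℕ → Poly
boundᴾ k c d = X+ c ^ᴾ k ⊕ k ! ⊛ X+ d

⟦boundᴾ⟧ : ∀ k c d x → ⟦ boundᴾ k c d ⟧ x ≡ (c + x) ^ k + k ! * (d + x)
⟦boundᴾ⟧ k c d x = trans (⟦⊕⟧ (X+ c ^ᴾ k) (k ! ⊛ X+ d) x) (cong₂ _+_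
  (trans (⟦^ᴾ⟧ (X+ c) k x) (cong (_^ k) (⟦X+⟧ c x)))
  (trans (⟦⊛⟧ (k !) (X+ d) x) (cong (k ! *_) (⟦X+⟧ d x))))

rising<boundᵇ : ℕ → Bool
rising<boundᵇ k = risingᴾ 0 k ⊕ (1 ∷ []) ≤ᶜ boundᴾ k ⌊ k /2⌋ 0

bound≤risingᵇ : ℕ → Bool
bound≤risingᵇ k = boundᴾ k (suc ⌊ k /2⌋) 2 ≤ᶜ risingᴾ 3 k

rising<bound : ∀ k → T (rising<boundᵇ k) → ∀ u → rising u k < (⌊ k /2⌋ + u) ^ k + k ! * u
rising<bound k cert u = subst₂ _≤_ lhs (⟦boundᴾ⟧ k ⌊ k /2⌋ 0 u)
  (≤ᶜ⇒⟦⟧≤ (risingᴾ 0 k ⊕ (1 ∷ [])) (boundᴾ k ⌊ k /2⌋ 0) cert u)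
  where
  lhs : ⟦ risingᴾ 0 k ⊕ (1 ∷ []) ⟧ u ≡ suc (rising u k)
  lhs = trans (⟦⊕⟧ (risingᴾ 0 k) (1 ∷ []) u)
          (trans (cong₂ _+_ (⟦risingᴾ⟧ 0 k u) (⟦const⟧ 1 u)) (+-comm (rising u k) 1))

bound≤rising : ∀ k → T (bound≤risingᵇ k) →
  ∀ u → (suc ⌊ k /2⌋ + u) ^ k + k ! * (2 + u) ≤ rising (3 + u) k
bound≤rising k cert u =
  subst₂ _≤_ (⟦boundᴾ⟧ k (suc ⌊ k /2⌋) 2 u) (⟦risingᴾ⟧ 3 k u)
    (≤ᶜ⇒⟦⟧≤ (boundᴾ k (suc ⌊ k /2⌋) 2) (risingᴾ 3 k) cert u)

simplex : ℕ → ℕ → ℕ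
simplex k m = (m + k ∸ 1) C k

simplex-zero : ∀ k → simplex (suc k) 0 ≡ 0
simplex-zero k = k>n⇒nCk≡0 (n<1+n k)

simplex-one : ∀ k → simplex k 1 ≡ 1
simplex-one k = nCn≡1 k

simplex-suc : ∀ k m → simplex (suc k) (2+ m) ≡ simplex (suc k) (suc m) + (m + suc k) C k
simplex-suc k m =
  trans (sym (nCk+nC[k+1]≡[n+1]C[k+1] (m + suc k) k)) (+-comm ((m + suc k) C k) _)

k≤n⇒0<nCk : ∀ {n k} → k ≤ n → 0 < n C k
k≤n⇒0<nCk {n} {zero} _ = s≤s z≤n
k≤n⇒0<nCk {suc n} {suc k} (s≤s k≤n) =
  subst (0 <_) (nCk+nC[k+1]≡[n+1]C[k+1] n k) (<-≤-trans (k≤n⇒0<nCk k≤n) (m≤m+n _ _))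

simplex-< : ∀ k m → simplex (suc k) m < simplex (suc k) (suc m)
simplex-< k zero = subst₂ _<_ (sym (simplex-zero k)) (sym (simplex-one (suc k))) (s≤s z≤n)
simplex-< k (suc m) = subst (simplex (suc k) (suc m) <_) (sym (simplex-suc k m))
  (m<m+n _ (k≤n⇒0<nCk (≤-trans (n≤1+n k) (m≤n+m (suc k) m))))

simplex-+ : ∀ k m d → simplex (suc k) m + d ≤ simplex (suc k) (m + d)
simplex-+ k m zero =
  ≤-reflexive (trans (+-identityʳ _) (cong (simplex (suc k)) (sym (+-identityʳ m))))
simplex-+ k m (suc d) = begin
  simplex (suc k) m + suc d     ≡⟨ +-suc _ d ⟩
  suc (simplex (suc k) m + d)   ≤⟨ s≤s (simplex-+ k m d) ⟩
  suc (simplex (suc k) (m + d)) ≤⟨ simplex-< k (m + d) ⟩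
  simplex (suc k) (suc m + d)   ≡⟨ cong (simplex (suc k)) (+-suc m d) ⟨
  simplex (suc k) (m + suc d)   ∎
  where open ≤-Reasoning

simplex-mono-≤ : ∀ k {m m′} → m ≤ m′ → simplex (suc k) m ≤ simplex (suc k) m′
simplex-mono-≤ k {m} m≤m′ with m≤n⇒∃[o]m+o≡n m≤m′
... | d , refl = ≤-trans (m≤m+n _ d) (simplex-+ k m d)

simplex-gap : ∀ k m → 2 + simplex (2+ k) (suc m) ≤ simplex (2+ k) (2+ m)
simplex-gap k m = begin
  2 + T₁                      ≡⟨ +-comm 2 T₁ ⟩
  T₁ + 2                      ≤⟨ +-monoʳ-≤ T₁ (+-mono-≤ (k≤n⇒0<nCk k≤n) (k≤n⇒0<nCk (m≤n+m (suc k) m))) ⟩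
  T₁ + (n C k + n C suc k)    ≡⟨ cong (_+_ T₁) (nCk+nC[k+1]≡[n+1]C[k+1] n k) ⟩
  T₁ + suc n C suc k          ≡⟨ cong (λ x → T₁ + x C suc k) (+-suc m (suc k)) ⟨
  T₁ + (m + 2+ k) C suc k     ≡⟨ simplex-suc (suc k) m ⟨
  simplex (2+ k) (2+ m)       ∎
  where
  open ≤-Reasoning
  n = m + suc k
  T₁ = simplex (2+ k) (suc m)
  k≤n : k ≤ n
  k≤n = ≤-trans (n≤1+n k) (m≤n+m (suc k) m)

k≤n⇒nPk≡nP′k : ∀ {n k} → k ≤ n → n P k ≡ n P′ k
k≤n⇒nPk≡nP′k k≤n = trans (nPk≡n!/[n∸k]! k≤n) (sym (nP′k≡n!/[n∸k]! k≤n))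

[m+k]P′k≡rising[1+m]k : ∀ m k → (m + k) P′ k ≡ rising (suc m) k
[m+k]P′k≡rising[1+m]k m zero = refl
[m+k]P′k≡rising[1+m]k m (suc k) = begin
  (m + suc k ∸ k) * ((m + suc k) P′ k) ≡⟨ cong (λ n → (n ∸ k) * (n P′ k)) (+-suc m k) ⟩
  (suc m + k ∸ k) * ((suc m + k) P′ k) ≡⟨ cong₂ _*_ (m+n∸n≡m (suc m) k) ([m+k]P′k≡rising[1+m]k (suc m) k) ⟩
  suc m * rising (2+ m) k              ∎
  where open ≡-Reasoning

simplex-rising : ∀ k m → k ! * simplex k m ≡ rising m k
simplex-rising zero zero = refl
simplex-rising (suc k) zero = trans (cong (suc k ! *_) (simplex-zero k)) (*-zeroʳ (suc k !))
simplex-rising k (suc m) = begin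
  k ! * ((m + k) C k)              ≡⟨ cong (k ! *_) (nCk≡nPk/k! k≤m+k) ⟩
  k ! * (((m + k) P k) / k !)      ≡⟨ cong (λ p → k ! * (p / k !)) (k≤n⇒nPk≡nP′k k≤m+k) ⟩
  k ! * (((m + k) P′ k) / k !)     ≡⟨ m*[n/m]≡n (k!∣nP′k k≤m+k) ⟩
  (m + k) P′ k                     ≡⟨ [m+k]P′k≡rising[1+m]k m k ⟩
  rising (suc m) k                 ∎
  where
  open ≡-Reasoning
  instance _ = k !≢0
  k≤m+k = m≤n+m k m

record InGap (k x m : ℕ) : Set where
  constructor between
  field
    above : simplex k m < x
    below : x < simplex k (suc m)

inGap? : ∀ k x m → Dec (InGap k x m)
inGap? k x m = map′ (λ (a , b) → between a b) (λ (between a b) → a , b)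
  (simplex k m <? x ×-dec x <? simplex k (suc m))

inGap⇒nonSimplex : ∀ {k x m} → InGap (suc k) x m → NonSimplex (suc k) x
inGap⇒nonSimplex {k} {x} {m} (between above below) = ≤-trans (s≤s z≤n) above , notSimplex
  where
  notSimplex : ¬ IsSimplex (suc k) x
  notSimplex (m′ , _ , x≡) with m′ ≤? m
  ... | yes m′≤m = <⇒≱ above (subst (_≤ simplex (suc k) m) (sym x≡) (simplex-mono-≤ k m′≤m))
  ... | no m′≰m =
    <⇒≱ below (subst (simplex (suc k) (suc m) ≤_) (sym x≡) (simplex-mono-≤ k (≰⇒> m′≰m)))

inGap[2,1] : ∀ k → InGap (2+ k) 2 1
inGap[2,1] k = between (subst (_< 2) (sym (simplex-one (2+ k))) ≤-refl)
  (subst (λ t → 2 + t ≤ simplex (2+ k) 2) (simplex-one (2+ k)) (simplex-gap k 0))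

nonSimplex⇒2≤ : ∀ {k z} → NonSimplex (suc k) z → 2 ≤ z
nonSimplex⇒2≤ {z = 0} (() , _)
nonSimplex⇒2≤ {k} {z = 1} (_ , notSimplex) = ⊥-elim (notSimplex (1 , ≤-refl , sym (simplex-one (suc k))))
nonSimplex⇒2≤ {z = 2+ _} _ = s≤s (s≤s z≤n)

inGap-suc : ∀ {k x m} → InGap (2+ k) x m →
  InGap (2+ k) (suc x) m ⊎ (suc x ≡ simplex (2+ k) (suc m) × InGap (2+ k) (2+ x) (suc m))
inGap-suc {k} {x} {m} (between above below) with suc x <? simplex (2+ k) (suc m)
... | yes x+1<T = inj₁ (between (m<n⇒m<1+n above) x+1<T)
... | no x+1≮T = inj₂ (x+1≡T , between (subst (_< 2+ x) x+1≡T ≤-refl)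
  (subst (λ t → 2 + t ≤ simplex (2+ k) (2+ m)) (sym x+1≡T) (simplex-gap k m)))
  where
  x+1≡T : suc x ≡ simplex (2+ k) (suc m)
  x+1≡T = ≤-antisym below (≮⇒≥ x+1≮T)

inGap-offset-< : ∀ {k n m m′} → m < m′ → InGap (suc k) (n + m) m → ¬ InGap (suc k) (n + m′) m′
inGap-offset-< {k} {n} {m} m<m′ (between _ below) (between above′ _) with m≤n⇒∃[o]m+o≡n m<m′
... | d , refl = <-irrefl refl (begin-strict
  simplex (suc k) (suc m + d)   <⟨ above′ ⟩
  n + (suc m + d)               ≡⟨ +-assoc n (suc m) d ⟨
  n + suc m + d                 ≡⟨ cong (_+ d) (+-suc n m) ⟩
  suc (n + m) + d               ≤⟨ +-monoˡ-≤ d below ⟩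
  simplex (suc k) (suc m) + d   ≤⟨ simplex-+ k (suc m) d ⟩
  simplex (suc k) (suc m + d)   ∎)
  where open ≤-Reasoning

inGap-offset-unique : ∀ {k n m m′} → InGap (suc k) (n + m) m → InGap (suc k) (n + m′) m′ → m ≡ m′
inGap-offset-unique {m = m} {m′} gap gap′ with <-cmp m m′
... | tri< m<m′ _ _ = ⊥-elim (inGap-offset-< m<m′ gap gap′)
... | tri≈ _ m≡m′ _ = m≡m′
... | tri> _ _ m′<m = ⊥-elim (inGap-offset-< m′<m gap′ gap)

module NonSimplexEnumeration {k n a : ℕ} (f : Fin (suc n) → ℕ)
  (satisfies : ∀ i → NonSimplex (2+ k) (f i))
  (increasing : ∀ i j → toℕ i < toℕ j → f i < f j)
  (bounded : ∀ i → f i ≤ a)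
  (attains : ∃ λ i → f i ≡ a)
  (complete : ∀ x → NonSimplex (2+ k) x → x ≤ a → ∃ λ i → f i ≡ x)
  where

  open Enumeration f satisfies increasing bounded attains complete public

  Offset : Fin (suc n) → Set
  Offset i = ∃ λ m → f i ≡ suc (toℕ i) + m × InGap (2+ k) (f i) m

  offset-zero : Offset zero
  offset-zero = 1 , f0≡2 , subst (λ x → InGap (2+ k) x 1) (sym f0≡2) (inGap[2,1] k)
    where
    f0≡2 : f zero ≡ 2
    f0≡2 = first-least (inGap⇒nonSimplex (inGap[2,1] k)) (λ z z<2 ns → <⇒≱ z<2 (nonSimplex⇒2≤ ns))

  offset-suc : ∀ i → Offset (inject₁ i) → Offset (suc i)
  offset-suc i (m , fi≡ , gap) = [ same-gap , next-gap ]′ (inGap-suc gap)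
    where
    x = f (inject₁ i)
    x≡ : x ≡ suc (toℕ i) + m
    x≡ = trans fi≡ (cong (λ j → suc j + m) (toℕ-inject₁ i))

    same-gap : InGap (2+ k) (suc x) m → Offset (suc i)
    same-gap gap₁ = m , trans fsi≡ (cong suc x≡) , subst (λ y → InGap (2+ k) y m) (sym fsi≡) gap₁
      where
      fsi≡ : f (suc i) ≡ suc x
      fsi≡ = next-least i (inGap⇒nonSimplex gap₁) ≤-refl (λ z x<z z<x+1 _ → <⇒≱ x<z (≤-pred z<x+1))

    next-gap : suc x ≡ simplex (2+ k) (suc m) × InGap (2+ k) (2+ x) (suc m) → Offset (suc i)
    next-gap (x+1≡T , gap₂) = suc m , trans fsi≡ (cong 2+ (trans x≡ (sym (+-suc (toℕ i) m))))
                            , subst (λ y → InGap (2+ k) y (suc m)) (sym fsi≡) gap₂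
      where
      skipped : ∀ z → x < z → z < 2+ x → ¬ NonSimplex (2+ k) z
      skipped z x<z z<x+2 (_ , notSimplex) =
        notSimplex (suc m , s≤s z≤n , trans (≤-antisym (≤-pred z<x+2) x<z) x+1≡T)
      fsi≡ : f (suc i) ≡ 2+ x
      fsi≡ = next-least i (inGap⇒nonSimplex gap₂) (m<n⇒m<1+n ≤-refl) skipped

  offsets : ∀ i → Offset i
  offsets = <-weakInduction Offset offset-zero offset-suc

nthNonSimplex≡ : ∀ {k n m a} → 1 ≤ n → InGap (2+ k) (n + m) m → NthNonSimplex (2+ k) n a → a ≡ n + m
nthNonSimplex≡ {k} {suc n} {m} {a} _ gap (f , satisfies , increasing , bounded , attains , complete) =
  let m′ , last≡ , gap′ = offsets (fromℕ n)
      last≡′ = trans last≡ (cong (λ j → suc j + m′) (toℕ-fromℕ n))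
      m≡m′ = inGap-offset-unique gap (subst (λ x → InGap (2+ k) x m′) last≡′ gap′)
  in trans (sym last≡a) (trans last≡′ (cong (_+_ (suc n)) (sym m≡m′)))
  where open NonSimplexEnumeration f satisfies increasing bounded attains complete

simplex[j]<n+j : ∀ {k n j} → T (rising<boundᵇ k) → (⌊ k /2⌋ + j) ^ k ≤ k ! * n → simplex k j < n + j
simplex[j]<n+j {k} {n} {j} cert root≤ = *-cancelˡ-< (k !) _ _ (begin-strict
  k ! * simplex k j              ≡⟨ simplex-rising k j ⟩
  rising j k                     <⟨ rising<bound k cert j ⟩
  (⌊ k /2⌋ + j) ^ k + k ! * j    ≤⟨ +-monoˡ-≤ (k ! * j) root≤ ⟩
  k ! * n + k ! * j              ≡⟨ *-distribˡ-+ (k !) n j ⟨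
  k ! * (n + j)                  ∎)
  where open ≤-Reasoning

n+[2+j]<simplex[3+j] : ∀ {k n j} → T (bound≤risingᵇ k) → k ! * n < suc (⌊ k /2⌋ + j) ^ k →
  n + (2 + j) < simplex k (3 + j)
n+[2+j]<simplex[3+j] {k} {n} {j} cert <root = *-cancelˡ-< (k !) _ _ (begin-strict
  k ! * (n + (2 + j))                      ≡⟨ *-distribˡ-+ (k !) n (2 + j) ⟩
  k ! * n + k ! * (2 + j)                  <⟨ +-monoˡ-< (k ! * (2 + j)) <root ⟩
  (suc ⌊ k /2⌋ + j) ^ k + k ! * (2 + j)    ≤⟨ bound≤rising k cert j ⟩
  rising (3 + j) k                         ≡⟨ simplex-rising k (3 + j) ⟨
  k ! * simplex k (3 + j)                  ∎)
  where open ≤-Reasoning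

Piecewise : ℤ → ℕ → ℕ → ℕ → Set
Piecewise v X Y a =
    ((+ X ≤ℤ v +ℤ + 1) × + a ≡ v +ℤ + 2)
  ⊎ ((¬ (+ X ≤ℤ v +ℤ + 1)) × (v <ℤ + Y) × + a ≡ v)
  ⊎ ((¬ (+ X ≤ℤ v +ℤ + 1)) × (¬ (v <ℤ + Y)) × + a ≡ v +ℤ + 1)

piecewise? : ∀ v X Y a → Dec (Piecewise v X Y a)
piecewise? v X Y a =
      (+ X ℤ.≤? v +ℤ + 1 ×-dec + a ℤ.≟ v +ℤ + 2)
  ⊎-dec (¬? (+ X ℤ.≤? v +ℤ + 1) ×-dec v ℤ.<? + Y ×-dec + a ℤ.≟ v)
  ⊎-dec (¬? (+ X ℤ.≤? v +ℤ + 1) ×-dec ¬? (v ℤ.<? + Y) ×-dec + a ℤ.≟ v +ℤ + 1)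

Piecewise-cong : ∀ {v v′ X X′ Y Y′ a} → v ≡ v′ → X ≡ X′ → Y ≡ Y′ →
  Piecewise v X Y a → Piecewise v′ X′ Y′ a
Piecewise-cong refl refl refl p = p

NonSimplexFormula : ℕ → ℕ → ℕ → ℕ → Set
NonSimplexFormula k n s =
  Piecewise (+ n +ℤ + s -ℤ + ⌊ k /2⌋) ((s + ⌈ k /2⌉ + 1) C k) ((s + ⌈ k /2⌉) C k)

window⇒piecewise : ∀ {k n j a} → 1 ≤ n →
  simplex (2+ k) j < n + j → n + (2 + j) < simplex (2+ k) (3 + j) → NthNonSimplex (2+ k) n a →
  Piecewise (+ (n + j)) (simplex (2+ k) (2 + j)) (simplex (2+ k) (1 + j)) a
window⇒piecewise {k} {n} {j} 1≤n lower upper nth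
  with simplex (2+ k) (2 + j) ≤? n + j + 1 | n + j <? simplex (2+ k) (1 + j)
... | yes X≤v+1 | _ =
  inj₁ (+≤+ X≤v+1 , cong +_ (trans (nthNonSimplex≡ 1≤n gap nth) (ℕ+.x∙yz≈xz∙y n 2 j)))
  where
  gap : InGap (2+ k) (n + (2 + j)) (2 + j)
  gap = between
    (≤-<-trans X≤v+1 (subst (n + j + 1 <_) (sym (ℕ+.x∙yz≈xz∙y n 2 j)) (+-monoʳ-< (n + j) ≤-refl)))
    upper
... | no X≰v+1 | yes v<Y =
  inj₂ (inj₁ (X≰v+1 ∘ ℤ.drop‿+≤+ , +<+ v<Y , cong +_ (nthNonSimplex≡ 1≤n (between lower v<Y) nth)))
... | no X≰v+1 | no v≮Y =
  inj₂ (inj₂ (X≰v+1 ∘ ℤ.drop‿+≤+ , v≮Y ∘ ℤ.drop‿+<+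
             , cong +_ (trans (nthNonSimplex≡ 1≤n gap nth) (ℕ+.x∙yz≈xz∙y n 1 j))))
  where
  gap : InGap (2+ k) (n + (1 + j)) (1 + j)
  gap = between
    (≤-<-trans (≮⇒≥ v≮Y) (subst (n + j <_) (sym (ℕ+.x∙yz≈xz∙y n 1 j)) (m<m+n (n + j) ≤-refl)))
    (subst (_< simplex (2+ k) (2 + j)) (sym (ℕ+.x∙yz≈xz∙y n 1 j)) (≰⇒> X≰v+1))

SmallRootCase : ℕ → ℕ → ℕ → Set
SmallRootCase k n s = 1 ≤ n → IsFloorRoot k (k ! * n) s →
  ∃ λ m → m < suc n × InGap k (n + m) m × NonSimplexFormula k n s (n + m)

smallRootCase? : ∀ k n s → Dec (SmallRootCase k n s)
smallRootCase? k n s =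
  1 ≤? n →-dec (s ^ k ≤? k ! * n ×-dec k ! * n <? suc s ^ k) →-dec
    anyUpTo? (λ m → inGap? k (n + m) m ×-dec piecewise? _ _ _ (n + m)) (suc n)

smallRootBound : ℕ → ℕ
smallRootBound k = suc (⌊ k /2⌋ ^ k / k !)
  where instance _ = k !≢0

SmallRootCases : ℕ → Set
SmallRootCases k = ∀ {n} → n < smallRootBound k → ∀ {s} → s < ⌊ k /2⌋ → SmallRootCase k n s

smallRootCases? : ∀ k → Dec (SmallRootCases k)
smallRootCases? k = allUpTo? (λ n → allUpTo? (λ s → smallRootCase? k n s) ⌊ k /2⌋) (smallRootBound k)

smallRoot⇒n<bound : ∀ {k n s} → k ! * n < suc s ^ k → s < ⌊ k /2⌋ → n < smallRootBound k
smallRoot⇒n<bound {k} {n} {s} <root s<t = s≤s (begin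
  n                 ≡⟨ m*n/n≡m n (k !) ⟨
  n * k ! / k !     ≤⟨ /-monoˡ-≤ (k !) n*k!≤t^k ⟩
  ⌊ k /2⌋ ^ k / k ! ∎)
  where
  open ≤-Reasoning
  instance _ = k !≢0
  n*k!≤t^k : n * k ! ≤ ⌊ k /2⌋ ^ k
  n*k!≤t^k = begin
    n * k !       ≡⟨ *-comm n (k !) ⟩
    k ! * n       ≤⟨ <⇒≤ <root ⟩
    suc s ^ k     ≤⟨ ^-monoˡ-≤ k s<t ⟩
    ⌊ k /2⌋ ^ k   ∎

Certificate : ℕ → Set
Certificate k = T (rising<boundᵇ k) × T (bound≤risingᵇ k) × SmallRootCases k

certificate : ∀ {k} → k < 14 → Certificate (2+ k)
certificate = toWitness {a? = allUpTo? certificate? 14} _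
  where
  certificate? : ∀ k → Dec (Certificate (2+ k))
  certificate? k = T? (rising<boundᵇ (2+ k)) ×-dec T? (bound≤risingᵇ (2+ k)) ×-dec smallRootCases? (2+ k)

smallRoot⇒nonSimplexFormula : ∀ {k n s a} → SmallRootCases (2+ k) → s < ⌊ 2+ k /2⌋ → 1 ≤ n →
  IsFloorRoot (2+ k) (2+ k ! * n) s → NthNonSimplex (2+ k) n a → NonSimplexFormula (2+ k) n s a
smallRoot⇒nonSimplexFormula {k} {n} {s} small s<t 1≤n root@(_ , <root) nth =
  let m , _ , gap , formula = small (smallRoot⇒n<bound <root s<t) s<t 1≤n root
  in subst (NonSimplexFormula (2+ k) n s) (sym (nthNonSimplex≡ 1≤n gap nth)) formula

n+[t+j]-t≡n+j : ∀ n t j → + n +ℤ + (t + j) -ℤ + t ≡ + (n + j)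
n+[t+j]-t≡n+j n t j = begin
  + (n + (t + j)) -ℤ + t   ≡⟨ ℤ.[+m]-[+n]≡m⊖n (n + (t + j)) t ⟩
  n + (t + j) ⊖ t          ≡⟨ cong (_⊖ t) (ℕ+.x∙yz≈y∙xz n t j) ⟩
  t + (n + j) ⊖ t          ≡⟨ ℤ.⊖-≥ (m≤m+n t (n + j)) ⟩
  + (t + (n + j) ∸ t)      ≡⟨ cong +_ (m+n∸m≡n t (n + j)) ⟩
  + (n + j)                ∎
  where open ≡-Reasoning

⌊k/2⌋+j+⌈k/2⌉≡j+k : ∀ k j → ⌊ k /2⌋ + j + ⌈ k /2⌉ ≡ j + k
⌊k/2⌋+j+⌈k/2⌉≡j+k k j =
  trans (ℕ+.xy∙z≈y∙xz ⌊ k /2⌋ j ⌈ k /2⌉) (cong (_+_ j) (⌊n/2⌋+⌈n/2⌉≡n k))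

largeRoot⇒nonSimplexFormula : ∀ {k n j a} → T (rising<boundᵇ (2+ k)) → T (bound≤risingᵇ (2+ k)) →
  1 ≤ n → IsFloorRoot (2+ k) (2+ k ! * n) (⌊ 2+ k /2⌋ + j) → NthNonSimplex (2+ k) n a →
  NonSimplexFormula (2+ k) n (⌊ 2+ k /2⌋ + j) a
largeRoot⇒nonSimplexFormula {k} {n} {j} below above 1≤n (root≤ , <root) nth =
  Piecewise-cong (sym (n+[t+j]-t≡n+j n ⌊ K /2⌋ j)) (sym X≡) (sym Y≡)
    (window⇒piecewise 1≤n (simplex[j]<n+j {K} {n} {j} below root≤)
                          (n+[2+j]<simplex[3+j] {K} {n} {j} above <root) nth)
  where
  K = 2+ k
  X≡ : (⌊ K /2⌋ + j + ⌈ K /2⌉ + 1) C K ≡ simplex K (2 + j)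
  X≡ = cong (_C K) (trans (cong (_+ 1) (⌊k/2⌋+j+⌈k/2⌉≡j+k K j)) (+-comm (j + K) 1))
  Y≡ : (⌊ K /2⌋ + j + ⌈ K /2⌉) C K ≡ simplex K (1 + j)
  Y≡ = cong (_C K) (⌊k/2⌋+j+⌈k/2⌉≡j+k K j)

certified⇒nonSimplexFormula : ∀ {k n s a} → Certificate (2+ k) → 1 ≤ n →
  IsFloorRoot (2+ k) (2+ k ! * n) s → NthNonSimplex (2+ k) n a → NonSimplexFormula (2+ k) n s a
certified⇒nonSimplexFormula {k} {s = s} (below , above , small) 1≤n root nth with s <? ⌊ 2+ k /2⌋
... | yes s<t = smallRoot⇒nonSimplexFormula small s<t 1≤n root nth
... | no s≮t with m≤n⇒∃[o]m+o≡n (≮⇒≥ s≮t)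
...   | j , refl = largeRoot⇒nonSimplexFormula below above 1≤n root nth

corollary5 : (k n s a : ℕ) → 1 < k → k ≤ 15 → 1 ≤ n →
    IsFloorRoot k ((k !) * n) s → NthNonSimplex k n a →
    ((+ ((s + ⌈ k /2⌉ + 1) C k) ≤ℤ (+ n +ℤ + s -ℤ + ⌊ k /2⌋) +ℤ + 1)
    × + a ≡ (+ n +ℤ + s -ℤ + ⌊ k /2⌋) +ℤ + 2)
    ⊎ ((¬ (+ ((s + ⌈ k /2⌉ + 1) C k) ≤ℤ (+ n +ℤ + s -ℤ + ⌊ k /2⌋) +ℤ + 1))
    × ((+ n +ℤ + s -ℤ + ⌊ k /2⌋) <ℤ + ((s + ⌈ k /2⌉) C k))
    × + a ≡ + n +ℤ + s -ℤ + ⌊ k /2⌋)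
    ⊎ ((¬ (+ ((s + ⌈ k /2⌉ + 1) C k) ≤ℤ (+ n +ℤ + s -ℤ + ⌊ k /2⌋) +ℤ + 1))
    × (¬ ((+ n +ℤ + s -ℤ + ⌊ k /2⌋) <ℤ + ((s + ⌈ k /2⌉) C k)))
    × + a ≡ (+ n +ℤ + s -ℤ + ⌊ k /2⌋) +ℤ + 1)
corollary5 1 _ _ _ (s≤s ()) _
corollary5 (2+ k) _ _ _ _ (s≤s k<14) = certified⇒nonSimplexFormula (certificate k<14)
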